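{- For $n\ge0$ set $c_{n,n}=n!$ and, for $0\le m<n$, $$c_{n,m}=\frac{(-1)^{n-m}m!(m+1)!}{(n+1)!}\sum_{k=0}^{n-m-1}\sum_{m=i_0<i_1<\cdots<i_{k+1}=n}\prod_{j=0}^k (i_{j+1}-i_j-1)!^2\binom{i_{j+1}}{i_j+1}\binom{i_{j+1}+1}{i_j}.$$ Then $b_n(x)=\sum_{m=0}^n c_{n,m}\binom{x+1}{m}$.
   Context: The Bernoulli polynomials of the second kind $b_n(x)$ are defined by $\sum_{n\ge0}\frac{b_n(x)}{n!}t^n=\frac{t(1+t)^x}{\ln(1+t)}$; $\binom{x+1}{m}=(x+1)x\cdots(x-m+2)/m!$. -}

module Defs where

open import Data.Nat as ℕ using (ℕ; zero; suc; _∸_; _≡ᵇ_)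
open import Data.Nat.Combinatorics using (_C_)
open import Data.Nat.Properties using (_!≢0)
open import Data.Integer using (+_)
open import Data.Rational using (ℚ; 0ℚ; 1ℚ; _+_; _*_; _-_; -_; _/_)
open import Data.List using (List; []; _∷_; map; foldr; upTo; zipWith; length; _++_)
open import Data.Vec using (Vec; []; _∷_; head; toList)
open import Data.Bool using (if_then_else_)

ℕ→ℚ : ℕ → ℚ
ℕ→ℚ n = (+ n) / 1

sgn : ℕ → ℚ
sgn zero    = 1ℚ
sgn (suc k) = - sgn k

sumℚ : List ℚ → ℚ
sumℚ = foldr _+_ 0ℚ

sumTo : ℕ → (ℕ → ℚ) → ℚ
sumTo n f = sumℚ (map f (upTo (suc n)))

binom : ℚ → ℕ → ℚ
binom x zero    = 1ℚ
binom x (suc k) = binom x k * (x - ℕ→ℚ k) * ((+ 1) / suc k)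

-- Multiplicative inverse of a power series f with f 0 = 1:
-- g 0 = 1,  g (n+1) = - Σ_{k=1}^{n+1} f k * g (n+1-k).
-- invRev f n = g n ∷ g (n-1) ∷ … ∷ g 0
invRev : (ℕ → ℚ) → (n : ℕ) → Vec ℚ (suc n)
invRev f zero    = 1ℚ ∷ []
invRev f (suc n) =
  (- sumℚ (zipWith _*_ (map (λ j → f (suc j)) (upTo (suc n))) (toList (invRev f n))))
  ∷ invRev f n

inv : (ℕ → ℚ) → ℕ → ℚ
inv f n = head (invRev f n)

-- coefficients of ln(1+t)/t = Σ_k (-1)^k t^k/(k+1)
-- (ln(1+t) = Σ_{k≥1} (-1)^{k+1} t^k / k)
logOver : ℕ → ℚ
logOver k = sgn k * ((+ 1) / suc k)

tOverLog : ℕ → ℚ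
tOverLog = inv logOver

-- Bernoulli polynomials of the second kind evaluated at x:
-- b_n(x)/n! = [t^n] (t/ln(1+t)) · (1+t)^x,  and [t^j](1+t)^x = binom x j.
bernoulli2 : ℕ → ℚ → ℚ
bernoulli2 n x = ℕ→ℚ (n ℕ.!) * sumTo n (λ k → tOverLog k * binom x (n ∸ k))

sublists : List ℕ → List (List ℕ)
sublists []       = [] ∷ []
sublists (x ∷ xs) = map (x ∷_) (sublists xs) ++ sublists xs

openInterval : ℕ → ℕ → List ℕ
openInterval a b = map (λ j → suc a ℕ.+ j) (upTo (b ∸ suc a))

weight : ℕ → ℕ → ℕ
weight a b = ((b ∸ a ∸ 1) ℕ.!) ℕ.* ((b ∸ a ∸ 1) ℕ.!) ℕ.* (b C suc a) ℕ.* (suc b C a)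

chainProd : List ℕ → ℕ
chainProd (a ∷ b ∷ rest) = weight a b ℕ.* chainProd (b ∷ rest)
chainProd _              = 1

-- Σ over chains m = i_0 < i_1 < … < i_{k+1} = n (for fixed k):
-- the chain is  m ∷ s ++ [n]  with s a k-element subset of (m,n)
chainSum : ℕ → ℕ → ℕ → ℕ
chainSum k m n =
  foldr ℕ._+_ 0
    (map (λ s → if length s ≡ᵇ k then chainProd (m ∷ s ++ (n ∷ [])) else 0)
         (sublists (openInterval m n)))

doubleSum : ℕ → ℕ → ℕ
doubleSum n m = foldr ℕ._+_ 0 (map (λ k → chainSum k m n) (upTo (n ∸ m)))

-- c_{n,m} (meaningful for m ≤ n)
c : ℕ → ℕ → ℚ
c n m = if m ≡ᵇ n then ℕ→ℚ (n ℕ.!)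
        else sgn (n ∸ m) * ℕ→ℚ ((m ℕ.!) ℕ.* (suc m ℕ.!))
             * (_/_ (+ 1) (suc n ℕ.!) {{(suc n) !≢0}}) * ℕ→ℚ (doubleSum n m)

module Submission where

-- With τ the coefficients of t/ln(1+t), b_n(x) = n! Σ_i τ_{n-i} binom x i.  Let D be the
-- inverse of the series A = (1+t)·ln(1+t)/t, so that τ_r = D_r + D_{r-1}.  Since
-- A_{j+1} = (-1)^j ρ_j with ρ_j = 1/((j+1)(j+2)), V_r = (-1)^r D_r obeys
-- V_{r+1} = Σ_j V_{r-j} ρ_j, a sum over chains of products of ρ.  The chain weights of
-- the paper telescope, weight(a,b)·a!(a+1)! = b!(b+1)!·ρ_{b-a-1}, so the double sum in
-- c_{n,m} is n!(n+1)!/(m!(m+1)!)·V_{n-m}, i.e. c_{n,m} = n! D_{n-m} and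
-- c_{n,i} + c_{n,i+1} = n! τ_{n-i}.  Pascal's rule then rewrites Σ_m c_{n,m} binom (x+1) m
-- as Σ_i (c_{n,i} + c_{n,i+1}) binom x i = b_n(x).

open import Defs
open import Data.Nat as ℕ using (ℕ; zero; suc; _∸_; _≡ᵇ_; _≤_; _<_; z≤n; s≤s; NonZero; _!)
import Data.Nat.Properties as ℕP
open import Data.Nat.Tactic.RingSolver using (solve-∀)
open import Data.Nat.ListAction using (sum)
open import Data.Nat.ListAction.Properties using (sum-++)
open import Data.Nat.Combinatorics using (_C_; nCk≡n!/k![n-k]!; k![n∸k]!∣n!)
open import Data.Nat.DivMod using (m/n*n≡m)
open import Data.Integer as ℤ using (+_)
import Data.Integer.Properties as ℤP
open import Data.Rational using (ℚ; 0ℚ; 1ℚ; _+_; _*_; _-_; -_; _/_; toℚᵘ)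
import Data.Rational.Properties as ℚP
import Data.Rational.Unnormalised as ℚᵘ
import Data.Rational.Unnormalised.Properties as ℚᵘP
open import Data.Rational.Solver using (module +-*-Solver)
open import Data.List using (List; []; _∷_; map; upTo; applyUpTo; zipWith; length; _++_)
import Data.List.Properties as LP
open import Data.List.Relation.Unary.All as All using (All; []; _∷_)
import Data.List.Relation.Unary.All.Properties as AllP
open import Data.Vec using (toList)
open import Data.Bool using (true; false; if_then_else_)
open import Data.Sum using (inj₁; inj₂)
open import Relation.Binary.PropositionalEquality
open import Relation.Nullary using (contradiction)

open +-*-Solver
open ≡-Reasoning

private
  toℚᵘ-ℕ→ℚ : ∀ n → toℚᵘ (ℕ→ℚ n) ℚᵘ.≃ ℚᵘ.mkℚᵘ (+ n) 0
  toℚᵘ-ℕ→ℚ n = ℚP.toℚᵘ-fromℚᵘ (ℚᵘ.mkℚᵘ (+ n) 0)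

ℕ→ℚ-+ : ∀ a b → ℕ→ℚ (a ℕ.+ b) ≡ ℕ→ℚ a + ℕ→ℚ b
ℕ→ℚ-+ a b = ℚP.toℚᵘ-injective (ℚᵘP.≃-trans (toℚᵘ-ℕ→ℚ (a ℕ.+ b))
  (ℚᵘP.≃-trans (ℚᵘP.≃-trans (ℚᵘ.*≡* eq) (ℚᵘP.+-cong (ℚᵘP.≃-sym (toℚᵘ-ℕ→ℚ a)) (ℚᵘP.≃-sym (toℚᵘ-ℕ→ℚ b))))
    (ℚᵘP.≃-sym (ℚP.toℚᵘ-homo-+ (ℕ→ℚ a) (ℕ→ℚ b)))))
  where
  eq : + (a ℕ.+ b) ℤ.* + 1 ≡ (+ a ℤ.* + 1 ℤ.+ + b ℤ.* + 1) ℤ.* + 1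
  eq = cong (ℤ._* + 1) (trans (ℤP.pos-+ a b)
         (sym (cong₂ ℤ._+_ (ℤP.*-identityʳ (+ a)) (ℤP.*-identityʳ (+ b)))))

ℕ→ℚ-* : ∀ a b → ℕ→ℚ (a ℕ.* b) ≡ ℕ→ℚ a * ℕ→ℚ b
ℕ→ℚ-* a b = ℚP.toℚᵘ-injective (ℚᵘP.≃-trans (toℚᵘ-ℕ→ℚ (a ℕ.* b))
  (ℚᵘP.≃-trans (ℚᵘP.≃-trans (ℚᵘ.*≡* (cong (ℤ._* + 1) (ℤP.pos-* a b)))
                             (ℚᵘP.*-cong (ℚᵘP.≃-sym (toℚᵘ-ℕ→ℚ a)) (ℚᵘP.≃-sym (toℚᵘ-ℕ→ℚ b))))
    (ℚᵘP.≃-sym (ℚP.toℚᵘ-homo-* (ℕ→ℚ a) (ℕ→ℚ b)))))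

ℕ→ℚ-inverse : ∀ k .{{_ : NonZero k}} → ℕ→ℚ k * ((+ 1) / k) ≡ 1ℚ
ℕ→ℚ-inverse (suc k) = ℚP.toℚᵘ-injective (ℚᵘP.≃-trans (ℚP.toℚᵘ-homo-* (ℕ→ℚ (suc k)) ((+ 1) / suc k))
  (ℚᵘP.≃-trans (ℚᵘP.*-cong (toℚᵘ-ℕ→ℚ (suc k)) (ℚP.toℚᵘ-fromℚᵘ (ℚᵘ.mkℚᵘ (+ 1) k))) (ℚᵘ.*≡* eq)))
  where
  eq : (+ suc k ℤ.* + 1) ℤ.* + 1 ≡ + 1 ℤ.* (+ 1 ℤ.* + suc k)
  eq = trans (ℤP.*-identityʳ (+ suc k ℤ.* + 1))
      (trans (ℤP.*-identityʳ (+ suc k))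
      (sym (trans (ℤP.*-identityˡ (+ 1 ℤ.* + suc k)) (ℤP.*-identityˡ (+ suc k)))))

∑ : ℕ → (ℕ → ℚ) → ℚ
∑ zero    f = 0ℚ
∑ (suc n) f = f 0 + ∑ n (λ i → f (suc i))

sumℚ-applyUpTo : ∀ n (f : ℕ → ℚ) → sumℚ (applyUpTo f n) ≡ ∑ n f
sumℚ-applyUpTo zero    f = refl
sumℚ-applyUpTo (suc n) f = cong (λ s → f 0 + s) (sumℚ-applyUpTo n (λ i → f (suc i)))

sumTo≡∑ : ∀ n f → sumTo n f ≡ ∑ (suc n) f
sumTo≡∑ n f = trans (cong sumℚ (LP.map-upTo f (suc n))) (sumℚ-applyUpTo (suc n) f)

∑-cong : ∀ n {f g : ℕ → ℚ} → (∀ i → i < n → f i ≡ g i) → ∑ n f ≡ ∑ n g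
∑-cong zero    eq = refl
∑-cong (suc n) eq = cong₂ _+_ (eq 0 (s≤s z≤n)) (∑-cong n (λ i i<n → eq (suc i) (s≤s i<n)))

∑-+ : ∀ n (f g : ℕ → ℚ) → ∑ n (λ i → f i + g i) ≡ ∑ n f + ∑ n g
∑-+ zero    f g = refl
∑-+ (suc n) f g = trans (cong (λ s → (f 0 + g 0) + s) (∑-+ n _ _))
  (solve 4 (λ a b s t → (a :+ b) :+ (s :+ t) := (a :+ s) :+ (b :+ t)) refl (f 0) (g 0) (∑ n _) (∑ n _))

∑-*ˡ : ∀ n a (f : ℕ → ℚ) → a * ∑ n f ≡ ∑ n (λ i → a * f i)
∑-*ˡ zero    a f = ℚP.*-zeroʳ a
∑-*ˡ (suc n) a f = trans (ℚP.*-distribˡ-+ a (f 0) (∑ n _)) (cong (λ s → a * f 0 + s) (∑-*ˡ n a _))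

∑-last : ∀ n (f : ℕ → ℚ) → ∑ (suc n) f ≡ ∑ n f + f n
∑-last zero    f = trans (ℚP.+-identityʳ (f 0)) (sym (ℚP.+-identityˡ (f 0)))
∑-last (suc n) f = trans (cong (λ s → f 0 + s) (∑-last n (λ i → f (suc i)))) (sym (ℚP.+-assoc (f 0) _ _))

suc[n∸suc-i] : ∀ {i n} → i < n → n ∸ i ≡ suc (n ∸ suc i)
suc[n∸suc-i] i<n = ℕP.+-∸-assoc 1 i<n

∑-reverse : ∀ n (f : ℕ → ℚ) → ∑ n f ≡ ∑ n (λ i → f (n ∸ suc i))
∑-reverse zero    f = refl
∑-reverse (suc n) f = begin
  f 0 + ∑ n (λ i → f (suc i))             ≡⟨ cong (λ s → f 0 + s) (∑-reverse n (λ i → f (suc i))) ⟩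
  f 0 + ∑ n (λ i → f (suc (n ∸ suc i)))   ≡⟨ cong (λ s → f 0 + s) (∑-cong n (λ i i<n → cong f (sym (suc[n∸suc-i] i<n)))) ⟩
  f 0 + ∑ n (λ i → f (n ∸ i))             ≡⟨ ℚP.+-comm (f 0) _ ⟩
  ∑ n (λ i → f (n ∸ i)) + f 0             ≡⟨ cong (λ j → ∑ n (λ i → f (n ∸ i)) + f j) (sym (ℕP.n∸n≡0 n)) ⟩
  ∑ n (λ i → f (n ∸ i)) + f (n ∸ n)       ≡⟨ sym (∑-last n (λ i → f (n ∸ i))) ⟩
  ∑ (suc n) (λ i → f (n ∸ i))             ∎

-- Writing B = binom x k, K = k, u = 1/(k+1), v = 1/(k+2), the two sides
-- differ by B (x - K) (v (1 - (1+K) u) + u ((2+K) v - 1)), which vanishes.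
private
  pascal-step : ∀ B x K u v → (1ℚ + K) * u ≡ 1ℚ → (1ℚ + (1ℚ + K)) * v ≡ 1ℚ →
    ((B * (x - K) * u) + B) * ((x + 1ℚ) - (1ℚ + K)) * v
      ≡ (B * (x - K) * u) * (x - (1ℚ + K)) * v + B * (x - K) * u
  pascal-step B x K u v hu hv = begin
    ((B * (x - K) * u) + B) * ((x + 1ℚ) - (1ℚ + K)) * v
      ≡⟨ solve 5 (λ B x K u v → ((B :* (x :- K) :* u) :+ B) :* ((x :+ con 1ℚ) :- (con 1ℚ :+ K)) :* v
           := (B :* (x :- K) :* u) :* (x :- (con 1ℚ :+ K)) :* v :+ B :* (x :- K) :* u
              :+ B :* (x :- K) :* (v :* (con 1ℚ :- (con 1ℚ :+ K) :* u) :+ u :* ((con 1ℚ :+ (con 1ℚ :+ K)) :* v :- con 1ℚ)))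
           refl B x K u v ⟩
    rhs + B * (x - K) * (v * (1ℚ - (1ℚ + K) * u) + u * ((1ℚ + (1ℚ + K)) * v - 1ℚ))
      ≡⟨ cong₂ (λ p q → rhs + B * (x - K) * (v * (1ℚ - p) + u * (q - 1ℚ))) hu hv ⟩
    rhs + B * (x - K) * (v * (1ℚ - 1ℚ) + u * (1ℚ - 1ℚ))
      ≡⟨ solve 4 (λ r b u v → r :+ b :* (v :* (con 1ℚ :- con 1ℚ) :+ u :* (con 1ℚ :- con 1ℚ)) := r) refl rhs (B * (x - K)) u v ⟩
    rhs ∎
    where rhs = (B * (x - K) * u) * (x - (1ℚ + K)) * v + B * (x - K) * u

binom-pascal : ∀ x k → binom (x + 1ℚ) (suc k) ≡ binom x (suc k) + binom x k
binom-pascal x zero = solve 1 (λ x → con 1ℚ :* (x :+ con 1ℚ :- con 0ℚ) :* con 1ℚ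
                                   := con 1ℚ :* (x :- con 0ℚ) :* con 1ℚ :+ con 1ℚ) refl x
binom-pascal x (suc k) = begin
  binom (x + 1ℚ) (suc k) * ((x + 1ℚ) - ℕ→ℚ (suc k)) * v
    ≡⟨ cong₂ (λ p q → p * ((x + 1ℚ) - q) * v) (binom-pascal x k) (ℕ→ℚ-+ 1 k) ⟩
  (binom x (suc k) + binom x k) * ((x + 1ℚ) - (1ℚ + K)) * v
    ≡⟨ pascal-step (binom x k) x K u v hu hv ⟩
  binom x (suc k) * (x - (1ℚ + K)) * v + binom x (suc k)
    ≡⟨ cong (λ q → binom x (suc k) * (x - q) * v + binom x (suc k)) (sym (ℕ→ℚ-+ 1 k)) ⟩
  binom x (suc (suc k)) + binom x (suc k) ∎
  where
  K = ℕ→ℚ k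
  u = (+ 1) / suc k
  v = (+ 1) / suc (suc k)
  hu : (1ℚ + K) * u ≡ 1ℚ
  hu = trans (cong (_* u) (sym (ℕ→ℚ-+ 1 k))) (ℕ→ℚ-inverse (suc k))
  hv : (1ℚ + (1ℚ + K)) * v ≡ 1ℚ
  hv = trans (cong (λ q → (1ℚ + q) * v) (sym (ℕ→ℚ-+ 1 k)))
      (trans (cong (_* v) (sym (ℕ→ℚ-+ 1 (suc k)))) (ℕ→ℚ-inverse (suc (suc k))))

∑-binom-succ : ∀ x N (C : ℕ → ℚ) → C (suc N) ≡ 0ℚ →
  ∑ (suc N) (λ m → C m * binom (x + 1ℚ) m) ≡ ∑ (suc N) (λ m → (C m + C (suc m)) * binom x m)
∑-binom-succ x N C C[N+1]≡0 = begin
  C 0 * 1ℚ + ∑ N (λ m → C (suc m) * binom (x + 1ℚ) (suc m))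
    ≡⟨ cong (λ s → C 0 * 1ℚ + s) (∑-cong N (λ m _ → trans (cong (C (suc m) *_) (binom-pascal x m))
                                                    (ℚP.*-distribˡ-+ (C (suc m)) _ _))) ⟩
  C 0 * 1ℚ + ∑ N (λ m → C (suc m) * binom x (suc m) + C (suc m) * binom x m)
    ≡⟨ cong (λ s → C 0 * 1ℚ + s) (∑-+ N (λ m → C (suc m) * binom x (suc m)) (λ m → C (suc m) * binom x m)) ⟩
  C 0 * 1ℚ + (S₁ + S₂)
    ≡⟨ solve 4 (λ a s₁ s₂ z → a :+ (s₁ :+ s₂) := (a :+ s₁) :+ (s₂ :+ con 0ℚ :* z)) refl (C 0 * 1ℚ) S₁ S₂ (binom x N) ⟩
  (C 0 * 1ℚ + S₁) + (S₂ + 0ℚ * binom x N)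
    ≡⟨ cong (λ z → (C 0 * 1ℚ + S₁) + (S₂ + z * binom x N)) (sym C[N+1]≡0) ⟩
  ∑ (suc N) (λ m → C m * binom x m) + (S₂ + C (suc N) * binom x N)
    ≡⟨ cong (λ s → ∑ (suc N) (λ m → C m * binom x m) + s) (sym (∑-last N (λ m → C (suc m) * binom x m))) ⟩
  ∑ (suc N) (λ m → C m * binom x m) + ∑ (suc N) (λ m → C (suc m) * binom x m)
    ≡⟨ sym (∑-+ (suc N) (λ m → C m * binom x m) (λ m → C (suc m) * binom x m)) ⟩
  ∑ (suc N) (λ m → C m * binom x m + C (suc m) * binom x m)
    ≡⟨ ∑-cong (suc N) (λ m _ → sym (ℚP.*-distribʳ-+ (binom x m) (C m) (C (suc m)))) ⟩
  ∑ (suc N) (λ m → (C m + C (suc m)) * binom x m) ∎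
  where
  S₁ = ∑ N (λ m → C (suc m) * binom x (suc m))
  S₂ = ∑ N (λ m → C (suc m) * binom x m)

bernoulli2-binom : ∀ n x → bernoulli2 n x ≡ ∑ (suc n) (λ i → (ℕ→ℚ (n !) * tOverLog (n ∸ i)) * binom x i)
bernoulli2-binom n x = begin
  n! * sumTo n (λ k → tOverLog k * binom x (n ∸ k))
    ≡⟨ cong (n! *_) (trans (sumTo≡∑ n term) (∑-reverse (suc n) term)) ⟩
  n! * ∑ (suc n) (λ i → tOverLog (n ∸ i) * binom x (n ∸ (n ∸ i)))
    ≡⟨ cong (n! *_) (∑-cong (suc n) (λ i i≤n → cong (λ j → tOverLog (n ∸ i) * binom x j)
                                                     (ℕP.m∸[m∸n]≡n (ℕP.≤-pred i≤n)))) ⟩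
  n! * ∑ (suc n) (λ i → tOverLog (n ∸ i) * binom x i)
    ≡⟨ ∑-*ˡ (suc n) n! (λ i → tOverLog (n ∸ i) * binom x i) ⟩
  ∑ (suc n) (λ i → n! * (tOverLog (n ∸ i) * binom x i))
    ≡⟨ ∑-cong (suc n) (λ i _ → sym (ℚP.*-assoc n! (tOverLog (n ∸ i)) (binom x i))) ⟩
  ∑ (suc n) (λ i → (n! * tOverLog (n ∸ i)) * binom x i) ∎
  where
  n! = ℕ→ℚ (n !)
  term = λ k → tOverLog k * binom x (n ∸ k)

conv : (ℕ → ℚ) → (ℕ → ℚ) → ℕ → ℚ
conv f g n = ∑ (suc n) (λ k → f k * g (n ∸ k))

-- Multiplication by t.
shift : (ℕ → ℚ) → ℕ → ℚ
shift g zero    = 0ℚ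
shift g (suc r) = g r

conv-cong : ∀ n {f f′ g g′ : ℕ → ℚ} → (∀ i → f i ≡ f′ i) → (∀ i → g i ≡ g′ i) → conv f g n ≡ conv f′ g′ n
conv-cong n f≗f′ g≗g′ = ∑-cong (suc n) (λ i _ → cong₂ _*_ (f≗f′ i) (g≗g′ (n ∸ i)))

conv-+ˡ : ∀ n f g h → conv (λ k → f k + g k) h n ≡ conv f h n + conv g h n
conv-+ˡ n f g h = trans (∑-cong (suc n) (λ i _ → ℚP.*-distribʳ-+ (h (n ∸ i)) (f i) (g i)))
  (∑-+ (suc n) (λ i → f i * h (n ∸ i)) (λ i → g i * h (n ∸ i)))

conv-+ʳ : ∀ n f g h → conv f (λ k → g k + h k) n ≡ conv f g n + conv f h n
conv-+ʳ n f g h = trans (∑-cong (suc n) (λ i _ → ℚP.*-distribˡ-+ (f i) (g (n ∸ i)) (h (n ∸ i))))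
  (∑-+ (suc n) (λ i → f i * g (n ∸ i)) (λ i → f i * h (n ∸ i)))

conv-shiftˡ : ∀ n f g → conv (shift f) g (suc n) ≡ conv f g n
conv-shiftˡ n f g = trans (cong (λ z → z + conv f g n) (ℚP.*-zeroˡ (g (suc n)))) (ℚP.+-identityˡ (conv f g n))

conv-shiftʳ : ∀ n f g → conv f (shift g) (suc n) ≡ conv f g n
conv-shiftʳ n f g = begin
  ∑ (suc (suc n)) (λ k → f k * shift g (suc n ∸ k))
    ≡⟨ ∑-last (suc n) (λ k → f k * shift g (suc n ∸ k)) ⟩
  ∑ (suc n) (λ k → f k * shift g (suc n ∸ k)) + f (suc n) * shift g (n ∸ n)
    ≡⟨ cong₂ _+_ (∑-cong (suc n) (λ k k≤n → cong (λ j → f k * shift g j) (ℕP.+-∸-assoc 1 (ℕP.≤-pred k≤n))))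
                 (trans (cong (λ j → f (suc n) * shift g j) (ℕP.n∸n≡0 n)) (ℚP.*-zeroʳ (f (suc n)))) ⟩
  conv f g n + 0ℚ ≡⟨ ℚP.+-identityʳ _ ⟩
  conv f g n ∎

inv-succ : ∀ f n → inv f (suc n) ≡ - ∑ (suc n) (λ j → f (suc j) * inv f (n ∸ j))
inv-succ f n = cong -_ (begin
  sumℚ (zipWith _*_ (map (λ j → f (suc j)) (upTo (suc n))) (toList (invRev f n)))
    ≡⟨ cong₂ (λ p q → sumℚ (zipWith _*_ p q)) (LP.map-upTo (λ j → f (suc j)) (suc n)) (invRev-list n) ⟩
  sumℚ (zipWith _*_ (applyUpTo (λ j → f (suc j)) (suc n)) (applyUpTo (λ j → inv f (n ∸ j)) (suc n)))
    ≡⟨ cong sumℚ (zipWith-applyUpTo (suc n) (λ j → f (suc j)) (λ j → inv f (n ∸ j))) ⟩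
  sumℚ (applyUpTo (λ j → f (suc j) * inv f (n ∸ j)) (suc n))
    ≡⟨ sumℚ-applyUpTo (suc n) (λ j → f (suc j) * inv f (n ∸ j)) ⟩
  ∑ (suc n) (λ j → f (suc j) * inv f (n ∸ j)) ∎)
  where
  invRev-list : ∀ n → toList (invRev f n) ≡ applyUpTo (λ j → inv f (n ∸ j)) (suc n)
  invRev-list zero    = refl
  invRev-list (suc n) = cong (inv f (suc n) ∷_) (invRev-list n)
  zipWith-applyUpTo : ∀ k (g h : ℕ → ℚ) →
    zipWith _*_ (applyUpTo g k) (applyUpTo h k) ≡ applyUpTo (λ j → g j * h j) k
  zipWith-applyUpTo zero    g h = refl
  zipWith-applyUpTo (suc k) g h = cong (g 0 * h 0 ∷_) (zipWith-applyUpTo k (λ j → g (suc j)) (λ j → h (suc j)))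

inv-inverse : ∀ f → f 0 ≡ 1ℚ → ∀ n → conv f (inv f) (suc n) ≡ 0ℚ
inv-inverse f f0≡1 n = begin
  f 0 * inv f (suc n) + S ≡⟨ cong₂ (λ p q → p * q + S) f0≡1 (inv-succ f n) ⟩
  1ℚ * (- S) + S          ≡⟨ solve 1 (λ s → con 1ℚ :* (:- s) :+ s := con 0ℚ) refl S ⟩
  0ℚ                      ∎
  where S = ∑ (suc n) (λ j → f (suc j) * inv f (n ∸ j))

inv-unique : ∀ f e → f 0 ≡ 1ℚ → e 0 ≡ 1ℚ → (∀ n → conv f e (suc n) ≡ 0ℚ) → ∀ n → e n ≡ inv f n
inv-unique f e f0≡1 e0≡1 fe≡1 n = below n n ℕP.≤-refl
  where
  below : ∀ n m → m ≤ n → e m ≡ inv f m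
  below n       zero    _         = e0≡1
  below (suc n) (suc m) (s≤s m≤n) = begin
    e (suc m)                  ≡⟨ solve 2 (λ a s → a := (con 1ℚ :* a :+ s) :+ (:- s)) refl (e (suc m)) S ⟩
    (1ℚ * e (suc m) + S) + - S ≡⟨ cong (λ p → (p * e (suc m) + S) + - S) (sym f0≡1) ⟩
    conv f e (suc m) + - S     ≡⟨ cong (_+ - S) (fe≡1 m) ⟩
    0ℚ + - S                   ≡⟨ ℚP.+-identityˡ (- S) ⟩
    - S                        ≡⟨ cong -_ (∑-cong (suc m) (λ j _ → cong (f (suc j) *_)
                                    (below n (m ∸ j) (ℕP.≤-trans (ℕP.m∸n≤m m j) m≤n)))) ⟩
    - ∑ (suc m) (λ j → f (suc j) * inv f (m ∸ j)) ≡⟨ sym (inv-succ f m) ⟩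
    inv f (suc m)              ∎
    where S = ∑ (suc m) (λ j → f (suc j) * e (m ∸ j))

-- The series A = (1+t) · ln(1+t)/t, its inverse D, and t/ln(1+t) = (1+t) · D.

A : ℕ → ℚ
A zero    = 1ℚ
A (suc j) = logOver (suc j) + logOver j

D : ℕ → ℚ
D = inv A

tOverLog≡[1+t]D : ∀ r → tOverLog r ≡ D r + shift D r
tOverLog≡[1+t]D r = sym (inv-unique logOver (λ k → D k + shift D k) refl refl logOver·[1+t]D≡1 r)
  where
  [1+t]logOver≡A : ∀ i → logOver i + shift logOver i ≡ A i
  [1+t]logOver≡A zero    = refl
  [1+t]logOver≡A (suc i) = refl
  logOver·[1+t]D≡1 : ∀ n → conv logOver (λ k → D k + shift D k) (suc n) ≡ 0ℚ
  logOver·[1+t]D≡1 n = begin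
    conv logOver (λ k → D k + shift D k) (suc n)
      ≡⟨ conv-+ʳ (suc n) logOver D (shift D) ⟩
    conv logOver D (suc n) + conv logOver (shift D) (suc n)
      ≡⟨ cong (λ s → conv logOver D (suc n) + s) (trans (conv-shiftʳ n logOver D) (sym (conv-shiftˡ n logOver D))) ⟩
    conv logOver D (suc n) + conv (shift logOver) D (suc n)
      ≡⟨ sym (conv-+ˡ (suc n) logOver (shift logOver) D) ⟩
    conv (λ k → logOver k + shift logOver k) D (suc n)
      ≡⟨ conv-cong (suc n) {g = D} {g′ = D} [1+t]logOver≡A (λ _ → refl) ⟩
    conv A D (suc n)
      ≡⟨ inv-inverse A refl n ⟩
    0ℚ ∎

sgn-+ : ∀ a b → sgn (a ℕ.+ b) ≡ sgn a * sgn b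
sgn-+ zero    b = sym (ℚP.*-identityˡ (sgn b))
sgn-+ (suc a) b = trans (cong -_ (sgn-+ a b)) (solve 2 (λ x y → :- (x :* y) := (:- x) :* y) refl (sgn a) (sgn b))

sgn-square : ∀ j → sgn j * sgn j ≡ 1ℚ
sgn-square zero    = refl
sgn-square (suc j) = trans (solve 1 (λ x → (:- x) :* (:- x) := x :* x) refl (sgn j)) (sgn-square j)

sgn-∸ : ∀ {j n} → j ≤ n → sgn n * sgn j ≡ sgn (n ∸ j)
sgn-∸ {j} {n} j≤n = begin
  sgn n * sgn j                     ≡⟨ cong (λ z → sgn z * sgn j) (sym (ℕP.m∸n+n≡m j≤n)) ⟩
  sgn ((n ∸ j) ℕ.+ j) * sgn j       ≡⟨ cong (_* sgn j) (sgn-+ (n ∸ j) j) ⟩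
  sgn (n ∸ j) * sgn j * sgn j       ≡⟨ ℚP.*-assoc (sgn (n ∸ j)) (sgn j) (sgn j) ⟩
  sgn (n ∸ j) * (sgn j * sgn j)     ≡⟨ cong (sgn (n ∸ j) *_) (sgn-square j) ⟩
  sgn (n ∸ j) * 1ℚ                  ≡⟨ ℚP.*-identityʳ _ ⟩
  sgn (n ∸ j)                       ∎

-- ρ j = 1/((j+1)(j+2)), the normalised weight of a gap of length j+1 in a chain.
ρ : ℕ → ℚ
ρ j = ((+ 1) / suc j) * ((+ 1) / suc (suc j))

-- A (j+1) = (-1)^j (1/(j+1) - 1/(j+2)) = (-1)^j ρ j.
A-suc : ∀ j → A (suc j) ≡ sgn j * ρ j
A-suc j = begin
  (- s) * v + s * u
    ≡⟨ solve 4 (λ s u v K → (:- s) :* v :+ s :* u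
          := s :* (u :* v) :+ s :* (:- u :* ((con 1ℚ :+ K) :* v :- con 1ℚ) :+ v :* (K :* u :- con 1ℚ))) refl s u v K ⟩
  s * (u * v) + s * (- u * ((1ℚ + K) * v - 1ℚ) + v * (K * u - 1ℚ))
    ≡⟨ cong₂ (λ p q → s * (u * v) + s * (- u * (p - 1ℚ) + v * (q - 1ℚ))) hv hu ⟩
  s * (u * v) + s * (- u * (1ℚ - 1ℚ) + v * (1ℚ - 1ℚ))
    ≡⟨ solve 3 (λ s u v → s :* (u :* v) :+ s :* (:- u :* (con 1ℚ :- con 1ℚ) :+ v :* (con 1ℚ :- con 1ℚ))
                  := s :* (u :* v)) refl s u v ⟩
  s * (u * v) ∎
  where
  s = sgn j
  u = (+ 1) / suc j
  v = (+ 1) / suc (suc j)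
  K = ℕ→ℚ (suc j)
  hu : K * u ≡ 1ℚ
  hu = ℕ→ℚ-inverse (suc j)
  hv : (1ℚ + K) * v ≡ 1ℚ
  hv = trans (cong (_* v) (sym (ℕ→ℚ-+ 1 (suc j)))) (ℕ→ℚ-inverse (suc (suc j)))

V : ℕ → ℚ
V r = sgn r * D r

V-suc : ∀ r → V (suc r) ≡ ∑ (suc r) (λ j → V (r ∸ j) * ρ j)
V-suc r = begin
  (- s) * D (suc r)   ≡⟨ cong ((- s) *_) (inv-succ A r) ⟩
  (- s) * (- S)       ≡⟨ solve 2 (λ s S → (:- s) :* (:- S) := s :* S) refl s S ⟩
  s * S               ≡⟨ ∑-*ˡ (suc r) s (λ j → A (suc j) * D (r ∸ j)) ⟩
  ∑ (suc r) (λ j → s * (A (suc j) * D (r ∸ j)))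
    ≡⟨ ∑-cong (suc r) (λ j j≤r → summand j (ℕP.≤-pred j≤r)) ⟩
  ∑ (suc r) (λ j → V (r ∸ j) * ρ j) ∎
  where
  s = sgn r
  S = ∑ (suc r) (λ j → A (suc j) * D (r ∸ j))
  summand : ∀ j → j ≤ r → s * (A (suc j) * D (r ∸ j)) ≡ V (r ∸ j) * ρ j
  summand j j≤r = begin
    s * (A (suc j) * D (r ∸ j))        ≡⟨ cong (λ z → s * (z * D (r ∸ j))) (A-suc j) ⟩
    s * (sgn j * ρ j * D (r ∸ j))
      ≡⟨ solve 4 (λ s g p d → s :* (g :* p :* d) := (s :* g) :* d :* p) refl s (sgn j) (ρ j) (D (r ∸ j)) ⟩
    (s * sgn j) * D (r ∸ j) * ρ j      ≡⟨ cong (λ z → z * D (r ∸ j) * ρ j) (sgn-∸ j≤r) ⟩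
    V (r ∸ j) * ρ j                    ∎

F : ℕ → ℕ
F a = a ! ℕ.* suc a !

choose*factorials : ∀ k s n → n ≡ k ℕ.+ s → (n C k) ℕ.* (k ! ℕ.* s !) ≡ n !
choose*factorials k s .(k ℕ.+ s) refl = begin
  ((k ℕ.+ s) C k) ℕ.* (k ! ℕ.* s !)
    ≡⟨ cong (λ z → ((k ℕ.+ s) C k) ℕ.* (k ! ℕ.* z !)) (sym (ℕP.m+n∸m≡n k s)) ⟩
  ((k ℕ.+ s) C k) ℕ.* (k ! ℕ.* (k ℕ.+ s ∸ k) !)
    ≡⟨ trans (cong (ℕ._* (k ! ℕ.* (k ℕ.+ s ∸ k) !)) (nCk≡n!/k![n-k]! k≤k+s))
             (m/n*n≡m {{k ℕP.!* (k ℕ.+ s ∸ k) !≢0}} (k![n∸k]!∣n! k≤k+s)) ⟩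
  (k ℕ.+ s) ! ∎
  where k≤k+s = ℕP.m≤m+n k s

weight-telescopeℕ : ∀ a t → weight a (a ℕ.+ suc t) ℕ.* F a ℕ.* (suc t ℕ.* suc (suc t)) ≡ F (a ℕ.+ suc t)
weight-telescopeℕ a t = begin
  weight a b ℕ.* F a ℕ.* (suc t ℕ.* suc (suc t))
    ≡⟨ cong (λ z → z ! ℕ.* z ! ℕ.* C₁ ℕ.* C₂ ℕ.* F a ℕ.* (suc t ℕ.* suc (suc t))) b∸a∸1≡t ⟩
  t ! ℕ.* t ! ℕ.* C₁ ℕ.* C₂ ℕ.* F a ℕ.* (suc t ℕ.* suc (suc t))
    ≡⟨ regroup (t !) C₁ C₂ (a !) (suc a) (suc t) (suc (suc t)) ⟩
  (C₁ ℕ.* (suc a ! ℕ.* t !)) ℕ.* (C₂ ℕ.* (a ! ℕ.* suc (suc t) !))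
    ≡⟨ cong₂ ℕ._*_ (choose*factorials (suc a) t b (ℕP.+-suc a t))
                   (choose*factorials a (suc (suc t)) (suc b) (sym (ℕP.+-suc a (suc t)))) ⟩
  F b ∎
  where
  b  = a ℕ.+ suc t
  C₁ = b C suc a
  C₂ = suc b C a
  b∸a∸1≡t : b ∸ a ∸ 1 ≡ t
  b∸a∸1≡t = cong (_∸ 1) (ℕP.m+n∸m≡n a (suc t))
  -- uses (a+1)! = (a+1) a!  and (t+2)! = (t+2)(t+1) t!
  regroup : ∀ X C₁ C₂ A sa st sst →
    X ℕ.* X ℕ.* C₁ ℕ.* C₂ ℕ.* (A ℕ.* (sa ℕ.* A)) ℕ.* (st ℕ.* sst)
      ≡ (C₁ ℕ.* ((sa ℕ.* A) ℕ.* X)) ℕ.* (C₂ ℕ.* (A ℕ.* (sst ℕ.* (st ℕ.* X))))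
  regroup = solve-∀

weight-telescope : ∀ a t b → b ≡ a ℕ.+ suc t → ℕ→ℚ (weight a b) * ℕ→ℚ (F a) ≡ ℕ→ℚ (F b) * ρ t
weight-telescope a t .(a ℕ.+ suc t) refl = begin
  w * fa                          ≡⟨ solve 2 (λ w fa → w :* fa := w :* fa :* con 1ℚ :* con 1ℚ) refl w fa ⟩
  w * fa * 1ℚ * 1ℚ                ≡⟨ cong₂ (λ p q → w * fa * p * q) (sym (ℕ→ℚ-inverse (suc t))) (sym (ℕ→ℚ-inverse (suc (suc t)))) ⟩
  w * fa * (st * u) * (sst * v)
    ≡⟨ solve 6 (λ w fa st u sst v → w :* fa :* (st :* u) :* (sst :* v) := (w :* fa :* (st :* sst)) :* (u :* v))
         refl w fa st u sst v ⟩
  (w * fa * (st * sst)) * (u * v) ≡⟨ cong (_* (u * v)) cleared ⟩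
  ℕ→ℚ (F (a ℕ.+ suc t)) * ρ t    ∎
  where
  w   = ℕ→ℚ (weight a (a ℕ.+ suc t))
  fa  = ℕ→ℚ (F a)
  st  = ℕ→ℚ (suc t)
  sst = ℕ→ℚ (suc (suc t))
  u   = (+ 1) / suc t
  v   = (+ 1) / suc (suc t)
  cleared : w * fa * (st * sst) ≡ ℕ→ℚ (F (a ℕ.+ suc t))
  cleared = begin
    w * fa * (st * sst)
      ≡⟨ cong₂ _*_ (sym (ℕ→ℚ-* (weight a (a ℕ.+ suc t)) (F a))) (sym (ℕ→ℚ-* (suc t) (suc (suc t)))) ⟩
    ℕ→ℚ (weight a (a ℕ.+ suc t) ℕ.* F a) * ℕ→ℚ (suc t ℕ.* suc (suc t))
      ≡⟨ sym (ℕ→ℚ-* (weight a (a ℕ.+ suc t) ℕ.* F a) (suc t ℕ.* suc (suc t))) ⟩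
    ℕ→ℚ (weight a (a ℕ.+ suc t) ℕ.* F a ℕ.* (suc t ℕ.* suc (suc t)))
      ≡⟨ cong ℕ→ℚ (weight-telescopeℕ a t) ⟩
    ℕ→ℚ (F (a ℕ.+ suc t)) ∎

sum-map-*ˡ : ∀ {X : Set} w (g : X → ℕ) xs → sum (map (λ s → w ℕ.* g s) xs) ≡ w ℕ.* sum (map g xs)
sum-map-*ˡ w g []       = sym (ℕP.*-zeroʳ w)
sum-map-*ˡ w g (x ∷ xs) = trans (cong (w ℕ.* g x ℕ.+_) (sum-map-*ˡ w g xs)) (sym (ℕP.*-distribˡ-+ w (g x) _))

sum-map-+ : ∀ {X : Set} (xs : List X) f g → sum (map (λ s → f s ℕ.+ g s) xs) ≡ sum (map f xs) ℕ.+ sum (map g xs)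
sum-map-+ []       f g = refl
sum-map-+ (x ∷ xs) f g = trans (cong (f x ℕ.+ g x ℕ.+_) (sum-map-+ xs f g)) (interchange (f x) (g x) _ _)
  where
  interchange : ∀ a b c d → a ℕ.+ b ℕ.+ (c ℕ.+ d) ≡ a ℕ.+ c ℕ.+ (b ℕ.+ d)
  interchange = solve-∀

sum-map-zero : ∀ {X : Set} (xs : List X) → sum (map (λ _ → 0) xs) ≡ 0
sum-map-zero []       = refl
sum-map-zero (x ∷ xs) = sum-map-zero xs

sum-map-swap : ∀ {X Y : Set} (xs : List X) (ys : List Y) (g : X → Y → ℕ) →
  sum (map (λ x → sum (map (g x) ys)) xs) ≡ sum (map (λ y → sum (map (λ x → g x y) xs)) ys)
sum-map-swap []       ys g = sym (sum-map-zero ys)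
sum-map-swap (x ∷ xs) ys g = trans (cong (sum (map (g x) ys) ℕ.+_) (sum-map-swap xs ys g))
  (sym (sum-map-+ ys (g x) (λ y → sum (map (λ x → g x y) xs))))

sum-map-cong : ∀ {X : Set} {xs : List X} {f g : X → ℕ} → All (λ s → f s ≡ g s) xs → sum (map f xs) ≡ sum (map g xs)
sum-map-cong []         = refl
sum-map-cong (eq ∷ eqs) = cong₂ ℕ._+_ eq (sum-map-cong eqs)

indicator-sum : ∀ N ℓ v → ℓ < N → sum (applyUpTo (λ k → if ℓ ≡ᵇ k then v else 0) N) ≡ v
indicator-sum (suc N) zero    v _         = trans (cong (v ℕ.+_) (zeros N)) (ℕP.+-identityʳ v)
  where
  zeros : ∀ N → sum (applyUpTo (λ _ → 0) N) ≡ 0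
  zeros zero    = refl
  zeros (suc N) = zeros N
indicator-sum (suc N) (suc ℓ) v (s≤s ℓ<N) = indicator-sum N ℓ v ℓ<N

-- The double sum of c (over the length k of a chain, then over
-- chains of that length) is a single sum over all subsets of the open
-- interval, which obeys a simple recursion in the first element of the
-- interval.

chainSumOver : ℕ → List ℕ → ℕ → ℕ
chainSumOver a l n = sum (map (λ s → chainProd (a ∷ s ++ n ∷ [])) (sublists l))

-- Either the chain skips x, or x is its second element.
chainSumOver-cons : ∀ a x l n → chainSumOver a (x ∷ l) n ≡ weight a x ℕ.* chainSumOver x l n ℕ.+ chainSumOver a l n
chainSumOver-cons a x l n = begin
  sum (map chain (map (x ∷_) SL ++ SL))             ≡⟨ cong sum (LP.map-++ chain (map (x ∷_) SL) SL) ⟩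
  sum (map chain (map (x ∷_) SL) ++ map chain SL)   ≡⟨ sum-++ (map chain (map (x ∷_) SL)) (map chain SL) ⟩
  sum (map chain (map (x ∷_) SL)) ℕ.+ sum (map chain SL)
    ≡⟨ cong (λ z → sum z ℕ.+ sum (map chain SL)) (sym (LP.map-∘ SL)) ⟩
  sum (map (λ s → weight a x ℕ.* chainProd (x ∷ s ++ n ∷ [])) SL) ℕ.+ chainSumOver a l n
    ≡⟨ cong (ℕ._+ chainSumOver a l n) (sum-map-*ˡ (weight a x) (λ s → chainProd (x ∷ s ++ n ∷ [])) SL) ⟩
  weight a x ℕ.* chainSumOver x l n ℕ.+ chainSumOver a l n ∎
  where
  chain = λ s → chainProd (a ∷ s ++ n ∷ [])
  SL = sublists l

sublists-length : ∀ l → All (λ s → length s ≤ length l) (sublists l)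
sublists-length []      = z≤n ∷ []
sublists-length (x ∷ l) = AllP.++⁺ (AllP.map⁺ (All.map s≤s (sublists-length l)))
                                   (All.map ℕP.m≤n⇒m≤1+n (sublists-length l))

length-openInterval : ∀ a b → length (openInterval a b) ≡ b ∸ suc a
length-openInterval a b = trans (LP.length-map (λ j → suc a ℕ.+ j) (upTo (b ∸ suc a)))
                                (LP.length-applyUpTo (λ i → i) (b ∸ suc a))

doubleSum≡chainSumOver : ∀ {m n} → m < n → doubleSum n m ≡ chainSumOver m (openInterval m n) n
doubleSum≡chainSumOver {m} {n} m<n =
  trans (sum-map-swap (upTo (n ∸ m)) SL ofLength) (sum-map-cong (All.map (λ {s} → single {s}) (sublists-length (openInterval m n))))
  where
  SL = sublists (openInterval m n)
  ofLength : ℕ → List ℕ → ℕ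
  ofLength k s = if length s ≡ᵇ k then chainProd (m ∷ s ++ n ∷ []) else 0
  -- every subset has exactly one length k < n - m
  single : ∀ {s} → length s ≤ length (openInterval m n) →
           sum (map (λ k → ofLength k s) (upTo (n ∸ m))) ≡ chainProd (m ∷ s ++ n ∷ [])
  single {s} len≤ = trans (cong sum (LP.map-upTo (λ k → ofLength k s) (n ∸ m)))
    (indicator-sum (n ∸ m) (length s) _
      (subst (length s <_) (sym (suc[n∸suc-i] m<n)) (s≤s (subst (length s ≤_) (length-openInterval m n) len≤))))

interval : ℕ → ℕ → List ℕ
interval lo zero    = []
interval lo (suc k) = lo ∷ interval (suc lo) k

openInterval≡interval : ∀ a b → openInterval a b ≡ interval (suc a) (b ∸ suc a)
openInterval≡interval a b =
  trans (LP.map-upTo (λ j → suc a ℕ.+ j) (b ∸ suc a)) (applyUpTo-interval (b ∸ suc a) (suc a) _ (λ _ → refl))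
  where
  applyUpTo-interval : ∀ k lo (h : ℕ → ℕ) → (∀ j → h j ≡ lo ℕ.+ j) → applyUpTo h k ≡ interval lo k
  applyUpTo-interval zero    lo h h≗ = refl
  applyUpTo-interval (suc k) lo h h≗ = cong₂ _∷_ (trans (h≗ 0) (ℕP.+-identityʳ lo))
    (applyUpTo-interval k (suc lo) (λ j → h (suc j)) (λ j → trans (h≗ (suc j)) (ℕP.+-suc lo j)))

-- Closed form of the chain sums: if lo = a + t + 1 and lo + len = n then
--   chainSumOver a [lo, n) n · F a = F n · Σ_{j≤len} V (len-j) ρ (t+j).
chainSum-closed : ∀ len a t lo n → lo ≡ a ℕ.+ suc t → lo ℕ.+ len ≡ n →
  ℕ→ℚ (chainSumOver a (interval lo len) n) * ℕ→ℚ (F a) ≡ ℕ→ℚ (F n) * ∑ (suc len) (λ j → V (len ∸ j) * ρ (t ℕ.+ j))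
chainSum-closed zero a t lo n lo≡ lo+0≡n = begin
  ℕ→ℚ (weight a n ℕ.* 1 ℕ.+ 0) * ℕ→ℚ (F a)
    ≡⟨ cong (λ z → ℕ→ℚ z * ℕ→ℚ (F a)) (trans (ℕP.+-identityʳ (weight a n ℕ.* 1)) (ℕP.*-identityʳ (weight a n))) ⟩
  ℕ→ℚ (weight a n) * ℕ→ℚ (F a)
    ≡⟨ weight-telescope a t n (trans (trans (sym lo+0≡n) (ℕP.+-identityʳ lo)) lo≡) ⟩
  ℕ→ℚ (F n) * ρ t
    ≡⟨ cong (ℕ→ℚ (F n) *_) (solve 1 (λ r → r := con 1ℚ :* con 1ℚ :* r :+ con 0ℚ) refl (ρ t)) ⟩
  ℕ→ℚ (F n) * (V 0 * ρ t + 0ℚ)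
    ≡⟨ cong (λ z → ℕ→ℚ (F n) * (V 0 * ρ z + 0ℚ)) (sym (ℕP.+-identityʳ t)) ⟩
  ℕ→ℚ (F n) * (V 0 * ρ (t ℕ.+ 0) + 0ℚ) ∎
chainSum-closed (suc len) a t lo n lo≡ lo+len≡n = begin
  ℕ→ℚ (chainSumOver a (lo ∷ interval (suc lo) len) n) * fa
    ≡⟨ cong (λ z → ℕ→ℚ z * fa) (chainSumOver-cons a lo (interval (suc lo) len) n) ⟩
  ℕ→ℚ (weight a lo ℕ.* H₁ ℕ.+ H₂) * fa
    ≡⟨ cong (_* fa) (trans (ℕ→ℚ-+ (weight a lo ℕ.* H₁) H₂) (cong (_+ h₂) (ℕ→ℚ-* (weight a lo) H₁))) ⟩
  (w * h₁ + h₂) * fa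
    ≡⟨ solve 4 (λ w h₁ h₂ fa → (w :* h₁ :+ h₂) :* fa := (w :* fa) :* h₁ :+ h₂ :* fa) refl w h₁ h₂ fa ⟩
  (w * fa) * h₁ + h₂ * fa
    ≡⟨ cong (λ z → z * h₁ + h₂ * fa) (weight-telescope a t lo lo≡) ⟩
  (flo * ρ t) * h₁ + h₂ * fa
    ≡⟨ solve 4 (λ flo r h₁ x → (flo :* r) :* h₁ :+ x := r :* (h₁ :* flo) :+ x) refl flo (ρ t) h₁ (h₂ * fa) ⟩
  ρ t * (h₁ * flo) + h₂ * fa
    ≡⟨ cong₂ (λ p q → ρ t * p + q) (trans lo-first (cong (fn *_) (sym (V-suc len)))) lo-skipped ⟩
  ρ t * (fn * V (suc len)) + fn * S
    ≡⟨ solve 4 (λ r fn v s → r :* (fn :* v) :+ fn :* s := fn :* (v :* r :+ s)) refl (ρ t) fn (V (suc len)) S ⟩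
  fn * (V (suc len) * ρ t + S)
    ≡⟨ cong₂ (λ p q → fn * (V (suc len) * ρ p + q)) (sym (ℕP.+-identityʳ t))
         (∑-cong (suc len) (λ j _ → cong (λ z → V (len ∸ j) * ρ z) (sym (ℕP.+-suc t j)))) ⟩
  fn * (V (suc len) * ρ (t ℕ.+ 0) + ∑ (suc len) (λ j → V (len ∸ j) * ρ (t ℕ.+ suc j))) ∎
  where
  H₁ = chainSumOver lo (interval (suc lo) len) n
  H₂ = chainSumOver a (interval (suc lo) len) n
  h₁ = ℕ→ℚ H₁
  h₂ = ℕ→ℚ H₂
  w = ℕ→ℚ (weight a lo)
  fa = ℕ→ℚ (F a)
  flo = ℕ→ℚ (F lo)
  fn = ℕ→ℚ (F n)
  S = ∑ (suc len) (λ j → V (len ∸ j) * ρ (suc t ℕ.+ j))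
  suc-lo+len≡n : suc lo ℕ.+ len ≡ n
  suc-lo+len≡n = trans (sym (ℕP.+-suc lo len)) lo+len≡n
  -- chains through lo: the rest is a chain starting at lo
  lo-first : h₁ * flo ≡ fn * ∑ (suc len) (λ j → V (len ∸ j) * ρ j)
  lo-first = chainSum-closed len lo 0 (suc lo) n (ℕP.+-comm 1 lo) suc-lo+len≡n
  -- chains avoiding lo: the first gap is at least t + 2
  lo-skipped : h₂ * fa ≡ fn * S
  lo-skipped = chainSum-closed len a (suc t) (suc lo) n (trans (cong suc lo≡) (sym (ℕP.+-suc a (suc t)))) suc-lo+len≡n

doubleSum-closed : ∀ {m n} → m < n → ℕ→ℚ (doubleSum n m) * ℕ→ℚ (F m) ≡ ℕ→ℚ (F n) * V (n ∸ m)
doubleSum-closed {m} {n} m<n = begin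
  ℕ→ℚ (doubleSum n m) * ℕ→ℚ (F m)
    ≡⟨ cong (λ z → ℕ→ℚ z * ℕ→ℚ (F m)) (trans (doubleSum≡chainSumOver m<n)
                                               (cong (λ l → chainSumOver m l n) (openInterval≡interval m n))) ⟩
  ℕ→ℚ (chainSumOver m (interval (suc m) len) n) * ℕ→ℚ (F m)
    ≡⟨ chainSum-closed len m 0 (suc m) n (ℕP.+-comm 1 m) (ℕP.m+[n∸m]≡n m<n) ⟩
  ℕ→ℚ (F n) * ∑ (suc len) (λ j → V (len ∸ j) * ρ j)
    ≡⟨ cong (ℕ→ℚ (F n) *_) (sym (V-suc len)) ⟩
  ℕ→ℚ (F n) * V (suc len)
    ≡⟨ cong (λ k → ℕ→ℚ (F n) * V k) (sym (suc[n∸suc-i] m<n)) ⟩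
  ℕ→ℚ (F n) * V (n ∸ m) ∎
  where len = n ∸ suc m

≡ᵇ-refl : ∀ n → (n ≡ᵇ n) ≡ true
≡ᵇ-refl zero    = refl
≡ᵇ-refl (suc n) = ≡ᵇ-refl n

≢⇒≡ᵇ-false : ∀ m n → m ≢ n → (m ≡ᵇ n) ≡ false
≢⇒≡ᵇ-false zero    zero    m≢n = contradiction refl m≢n
≢⇒≡ᵇ-false zero    (suc n) _   = refl
≢⇒≡ᵇ-false (suc m) zero    _   = refl
≢⇒≡ᵇ-false (suc m) (suc n) m≢n = ≢⇒≡ᵇ-false m n (λ m≡n → m≢n (cong suc m≡n))

1/[n+1]! : ℕ → ℚ
1/[n+1]! n = _/_ (+ 1) (suc n !) {{suc n ℕP.!≢0}}

c-off-diagonal : ∀ {n m} → m ≢ n → c n m ≡ sgn (n ∸ m) * ℕ→ℚ (F m) * 1/[n+1]! n * ℕ→ℚ (doubleSum n m)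
c-off-diagonal {n} {m} m≢n =
  cong (λ b → if b then ℕ→ℚ (n !) else sgn (n ∸ m) * ℕ→ℚ (F m) * 1/[n+1]! n * ℕ→ℚ (doubleSum n m))
       (≢⇒≡ᵇ-false m n m≢n)

-- Above the diagonal the double sum is empty.
c-above-diagonal : ∀ {n m} → n < m → c n m ≡ 0ℚ
c-above-diagonal {n} {m} n<m = begin
  c n m                                     ≡⟨ c-off-diagonal (ℕP.>⇒≢ n<m) ⟩
  X * ℕ→ℚ (sum (map (λ k → chainSum k m n) (upTo (n ∸ m))))
    ≡⟨ cong (λ r → X * ℕ→ℚ (sum (map (λ k → chainSum k m n) (upTo r)))) (ℕP.m≤n⇒m∸n≡0 (ℕP.<⇒≤ n<m)) ⟩
  X * 0ℚ                                    ≡⟨ ℚP.*-zeroʳ X ⟩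
  0ℚ                                        ∎
  where X = sgn (n ∸ m) * ℕ→ℚ (F m) * 1/[n+1]! n

-- c n m = n! · D (n-m) on and below the diagonal: off the diagonal the
-- signs (-1)^(n-m) of c and of V cancel and (n+1)! cancels against 1/(n+1)!.
c-closed : ∀ {n m} → m ≤ n → c n m ≡ ℕ→ℚ (n !) * D (n ∸ m)
c-closed {n} {m} m≤n with ℕP.m≤n⇒m<n∨m≡n m≤n
... | inj₂ refl = begin
  c n n                     ≡⟨ cong (λ b → if b then ℕ→ℚ (n !) else sgn (n ∸ n) * ℕ→ℚ (F n) * 1/[n+1]! n * ℕ→ℚ (doubleSum n n))
                                   (≡ᵇ-refl n) ⟩
  ℕ→ℚ (n !)                 ≡⟨ sym (ℚP.*-identityʳ _) ⟩
  ℕ→ℚ (n !) * D 0           ≡⟨ cong (λ r → ℕ→ℚ (n !) * D r) (sym (ℕP.n∸n≡0 n)) ⟩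
  ℕ→ℚ (n !) * D (n ∸ n)     ∎
... | inj₁ m<n = begin
  c n m                                         ≡⟨ c-off-diagonal (ℕP.<⇒≢ m<n) ⟩
  σ * ℕ→ℚ (F m) * 1/[n+1]! n * ℕ→ℚ (doubleSum n m)
    ≡⟨ solve 4 (λ σ f i d → σ :* f :* i :* d := σ :* i :* (d :* f)) refl σ (ℕ→ℚ (F m)) (1/[n+1]! n) (ℕ→ℚ (doubleSum n m)) ⟩
  σ * 1/[n+1]! n * (ℕ→ℚ (doubleSum n m) * ℕ→ℚ (F m))
    ≡⟨ cong (σ * 1/[n+1]! n *_) (doubleSum-closed m<n) ⟩
  σ * 1/[n+1]! n * (ℕ→ℚ (n ! ℕ.* suc n !) * (σ * D r))
    ≡⟨ cong (λ z → σ * 1/[n+1]! n * (z * (σ * D r))) (ℕ→ℚ-* (n !) (suc n !)) ⟩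
  σ * 1/[n+1]! n * ((n! * [n+1]!) * (σ * D r))
    ≡⟨ solve 5 (λ σ i a b d → σ :* i :* ((a :* b) :* (σ :* d)) := (σ :* σ) :* (b :* i) :* (a :* d))
         refl σ (1/[n+1]! n) n! [n+1]! (D r) ⟩
  (σ * σ) * ([n+1]! * 1/[n+1]! n) * (n! * D r)
    ≡⟨ cong₂ (λ p q → p * q * (n! * D r)) (sgn-square r) (ℕ→ℚ-inverse (suc n !) {{suc n ℕP.!≢0}}) ⟩
  1ℚ * 1ℚ * (n! * D r)      ≡⟨ solve 1 (λ z → con 1ℚ :* con 1ℚ :* z := z) refl (n! * D r) ⟩
  n! * D r                  ∎
  where
  r = n ∸ m
  σ = sgn r
  n! = ℕ→ℚ (n !)
  [n+1]! = ℕ→ℚ (suc n !)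

c-suc : ∀ {n i} → i ≤ n → c n (suc i) ≡ ℕ→ℚ (n !) * shift D (n ∸ i)
c-suc {n} {i} i≤n with ℕP.m≤n⇒m<n∨m≡n i≤n
... | inj₁ i<n = begin
  c n (suc i)                         ≡⟨ c-closed i<n ⟩
  ℕ→ℚ (n !) * D (n ∸ suc i)           ≡⟨ cong (λ r → ℕ→ℚ (n !) * shift D r) (sym (suc[n∸suc-i] i<n)) ⟩
  ℕ→ℚ (n !) * shift D (n ∸ i)         ∎
... | inj₂ refl = begin
  c n (suc n)                         ≡⟨ c-above-diagonal (ℕP.n<1+n n) ⟩
  0ℚ                                  ≡⟨ sym (ℚP.*-zeroʳ (ℕ→ℚ (n !))) ⟩
  ℕ→ℚ (n !) * shift D 0               ≡⟨ cong (λ r → ℕ→ℚ (n !) * shift D r) (sym (ℕP.n∸n≡0 n)) ⟩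
  ℕ→ℚ (n !) * shift D (n ∸ n)         ∎

c-consecutive : ∀ {n i} → i ≤ n → c n i + c n (suc i) ≡ ℕ→ℚ (n !) * tOverLog (n ∸ i)
c-consecutive {n} {i} i≤n = begin
  c n i + c n (suc i)                                   ≡⟨ cong₂ _+_ (c-closed i≤n) (c-suc i≤n) ⟩
  ℕ→ℚ (n !) * D (n ∸ i) + ℕ→ℚ (n !) * shift D (n ∸ i)   ≡⟨ sym (ℚP.*-distribˡ-+ (ℕ→ℚ (n !)) _ _) ⟩
  ℕ→ℚ (n !) * (D (n ∸ i) + shift D (n ∸ i))             ≡⟨ cong (ℕ→ℚ (n !) *_) (sym (tOverLog≡[1+t]D (n ∸ i))) ⟩
  ℕ→ℚ (n !) * tOverLog (n ∸ i)                          ∎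

corollary5p3 : (n : ℕ) (x : ℚ) →
    bernoulli2 n x ≡ sumTo n (λ m → c n m * binom (x + 1ℚ) m)
corollary5p3 n x = begin
  bernoulli2 n x
    ≡⟨ bernoulli2-binom n x ⟩
  ∑ (suc n) (λ i → (ℕ→ℚ (n !) * tOverLog (n ∸ i)) * binom x i)
    ≡⟨ ∑-cong (suc n) (λ i i≤n → cong (_* binom x i) (sym (c-consecutive (ℕP.≤-pred i≤n)))) ⟩
  ∑ (suc n) (λ i → (c n i + c n (suc i)) * binom x i)
    ≡⟨ sym (∑-binom-succ x n (c n) (c-above-diagonal (ℕP.n<1+n n))) ⟩
  ∑ (suc n) (λ m → c n m * binom (x + 1ℚ) m)
    ≡⟨ sym (sumTo≡∑ n (λ m → c n m * binom (x + 1ℚ) m)) ⟩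
  sumTo n (λ m → c n m * binom (x + 1ℚ) m) ∎
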